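{- Let $f,g\in\mathbb{K}[[x]]$ and $\lambda\in\mathbb{K}$, and let $T:\mathbb{K}[[x]]\to\mathbb{K}[[x]]$ be a contractive $\mathbb{K}$-linear operator with respect to the metric $d$. Then (a) $(f+g)(T)=f(T)+g(T)$; (b) $(\lambda f)(T)=\lambda f(T)$; (c) $f(T)\circ g(T)=(f\cdot g)(T)$, where $\cdot$ is the Cauchy product; (d) if $g(0)=0$, then $f(g(T))=(f\circ g)(T)$.
   Context: $\mathbb{K}$ is a field of characteristic zero and $\mathbb{K}[[x]]$ the ring of formal power series. For $s=\sum_n s_nx^n\ne 0$, its order is $\omega(s)=\min\{n: s_n\neq 0\}$, and $d(f,g)=2^{ -\omega(f-g)}$ (with $d(f,f)=0$) is a complete ultrametric on $\mathbb{K}[[x]]$. A map $T$ is contractive if there is $c\in[0,1)$ with $d(T(f),T(g))\le c\,d(f,g)$ for all $f,g$. For $f=\sum_{n\ge0}f_nx^n$ and a contractive linear $T$, $f(T)=\sum_{n\ge0}f_nT^n=f_0I+f_1T+f_2T^2+\cdots$, the series converging in $(\mathbb{K}[[x]],d)$; this is a continuous linear operator. -}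

module Defs where

open import Level using (Level; _⊔_) renaming (suc to lsuc)
open import Data.Nat as ℕ using (ℕ; zero; suc; _∸_)
open import Data.Product using (Σ; ∃; _×_; _,_)
open import Data.Rational as ℚ using (ℚ; ½; 1ℚ; 0ℚ)
open import Relation.Binary.PropositionalEquality using (_≡_)
open import Relation.Nullary using (¬_)
open import Algebra.Bundles using (CommutativeRing)

module _ {c ℓ : Level} (R : CommutativeRing c ℓ) where
  open CommutativeRing R
  natCast : ℕ → Carrier
  natCast zero    = 0#
  natCast (suc n) = 1# + natCast n

record Field₀ (c ℓ : Level) : Set (lsuc (c ⊔ ℓ)) where
  field
    commRing : CommutativeRing c ℓ
  open CommutativeRing commRing public hiding (ring)
  field
    0≉1       : ¬ (0# ≈ 1#)
    inverse   : ∀ x → ¬ (x ≈ 0#) → Σ Carrier (λ y → (x * y) ≈ 1#)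
    charZero  : ∀ n → natCast commRing n ≈ 0# → n ≡ 0

half^ : ℕ → ℚ
half^ zero    = 1ℚ
half^ (suc k) = ½ ℚ.* half^ k

module PowerSeries {c ℓ : Level} (K : Field₀ c ℓ) where
  open Field₀ K public

  Series : Set c
  Series = ℕ → Carrier

  _≈ₛ_ : Series → Series → Set ℓ
  f ≈ₛ g = ∀ n → f n ≈ g n

  sumBelow : ℕ → (ℕ → Carrier) → Carrier
  sumBelow zero    a = 0#
  sumBelow (suc n) a = sumBelow n a + a n

  _+ₛ_ : Series → Series → Series
  (f +ₛ g) n = f n + g n

  _·ₛ_ : Carrier → Series → Series
  (λ' ·ₛ f) n = λ' * f n

  zeroₛ : Series
  zeroₛ n = 0#

  oneₛ : Series
  oneₛ zero    = 1#
  oneₛ (suc n) = 0#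

  _⋆_ : Series → Series → Series
  (f ⋆ g) n = sumBelow (suc n) (λ i → f i * g (n ∸ i))

  _^ₛ_ : Series → ℕ → Series
  g ^ₛ zero    = oneₛ
  g ^ₛ (suc k) = g ⋆ (g ^ₛ k)

  -- composition f ∘ g (meaningful for g(0) = 0):
  -- (f∘g)_n = Σ_{k≤n} f_k (g^k)_n, the coefficient of the
  -- (then convergent) series Σ_k f_k g^k; terms k > n vanish.
  _∘ₛ_ : Series → Series → Series
  (f ∘ₛ g) n = sumBelow (suc n) (λ k → f k * (g ^ₛ k) n)

  -- u and v agree in all coefficients of index < k,
  -- i.e. d(u,v) ≤ 2^{-k}
  AgreeBelow : Series → Series → ℕ → Set ℓ
  AgreeBelow u v k = ∀ n → n ℕ.< k → u n ≈ v n

  OrderDiff : Series → Series → ℕ → Set ℓ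
  OrderDiff u v k = AgreeBelow u v k × ¬ (u k ≈ v k)

  -- d(u,v) ≤ r  (for r ≥ 0): either u = v, or 2^{-ω(u-v)} ≤ r;
  -- equivalently: whenever 2^{-m} > r, u and v agree below m+1.
  DistLe : Series → Series → ℚ → Set ℓ
  DistLe u v r = ∀ m → r ℚ.< half^ m → AgreeBelow u v (suc m)

  ConvergesTo : (ℕ → Series) → Series → Set ℓ
  ConvergesTo S L = ∀ k → ∃ λ N → ∀ M → N ℕ.≤ M → AgreeBelow (S M) L k

  Op : Set c
  Op = Series → Series

  _≈ₒ_ : Op → Op → Set (c ⊔ ℓ)
  A ≈ₒ B = ∀ h → A h ≈ₛ B h

  _+ₒ_ : Op → Op → Op
  (A +ₒ B) h = A h +ₛ B h

  _·ₒ_ : Carrier → Op → Op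
  (λ' ·ₒ A) h = λ' ·ₛ A h

  _∘ₒ_ : Op → Op → Op
  (A ∘ₒ B) h = A (B h)

  _^ₒ_ : Op → ℕ → Op
  (T ^ₒ zero)  h = h
  (T ^ₒ suc n) h = T ((T ^ₒ n) h)

  record Linear (T : Op) : Set (c ⊔ ℓ) where
    field
      cong     : ∀ {f g} → f ≈ₛ g → T f ≈ₛ T g
      additive : ∀ f g → T (f +ₛ g) ≈ₛ (T f +ₛ T g)
      homog    : ∀ a f → T (a ·ₛ f) ≈ₛ (a ·ₛ T f)

  -- contractive: ∃ c ∈ [0,1) with d(Tf,Tg) ≤ c·d(f,g) for all f,g.
  -- (For f = g both sides are 0, which holds by congruence; for f ≠ g
  -- d(f,g) = 2^{-k} with k = ω(f-g).)
  Contractive : Op → Set (c ⊔ ℓ)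
  Contractive T = ∃ λ (q : ℚ) → (0ℚ ℚ.≤ q) × (q ℚ.< 1ℚ) ×
    (∀ f g k → OrderDiff f g k → DistLe (T f) (T g) (q ℚ.* half^ k))

  partialSum : Series → Op → ℕ → Op
  partialSum f T zero    h = zeroₛ
  partialSum f T (suc N) h = partialSum f T N h +ₛ (f N ·ₛ (T ^ₒ N) h)

  IsEval : Op → Series → Op → Set (c ⊔ ℓ)
  IsEval T f A = ∀ h → ConvergesTo (λ N → partialSum f T N h) (A h)

{-# OPTIONS --safe #-}
-- A contractive linear T raises orders: if u and v agree below x^k, then T u and T v agree
-- below x^(k+1), so ω(T^k u) ≥ k. Hence the n-th coefficient of f(T) u is the finite sum
-- Σ_{k≤n} f_k (T^k u)_n, and (a)-(d) become identities of finite sums: (c) is the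
-- reindexing of a triangular double sum into the Cauchy product, and (d) follows from (c)
-- applied to the powers of G = g(T), which again raise orders because g(0) = 0.
module Submission where

open import Defs
open import Level using (Level; _⊔_)
open import Function using (id)
open import Data.Product using (_×_; _,_)
open import Data.Nat as ℕ using (ℕ; zero; suc; _∸_; _≤_; _<_; _≤′_; ≤′-refl; ≤′-step; s≤s; z≤n)
import Data.Nat.Properties as ℕP
open import Data.Rational as ℚ using (½; 1ℚ)
import Data.Rational.Properties as ℚP
open import Relation.Binary.PropositionalEquality as PE using (_≡_)
open import Relation.Nullary using (yes; no; ¬_)
open import Data.Empty using (⊥-elim)
import Algebra.Properties.Ring as RingProperties
import Algebra.Properties.CommutativeSemigroup as CommutativeSemigroupProperties
open import Algebra.Bundles using (CommutativeRing)

half^-positive : ∀ k → ℚ.Positive (half^ k)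
half^-positive zero    = _
half^-positive (suc k) = ℚP.pos*pos⇒pos ½ (half^ k) {{half^-positive k}}

*half^<half^ : ∀ {q} k → q ℚ.< 1ℚ → q ℚ.* half^ k ℚ.< half^ k
*half^<half^ k q<1 =
  ℚP.<-respʳ-≡ (ℚP.*-identityˡ (half^ k)) (ℚP.*-monoˡ-<-pos (half^ k) {{half^-positive k}} q<1)

module FiniteSums {c ℓ : Level} (K : Field₀ c ℓ) where
  open PowerSeries K
  open CommutativeSemigroupProperties +-commutativeSemigroup using (interchange)
  open import Relation.Binary.Reasoning.Setoid setoid

  sumBelow-cong : ∀ N {s t : ℕ → Carrier} → (∀ i → i < N → s i ≈ t i) → sumBelow N s ≈ sumBelow N t
  sumBelow-cong zero    s≈t = refl
  sumBelow-cong (suc N) s≈t =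
    +-cong (sumBelow-cong N (λ i i<N → s≈t i (ℕP.m<n⇒m<1+n i<N))) (s≈t N (ℕP.n<1+n N))

  sumBelow-zeros : ∀ N {t : ℕ → Carrier} → (∀ i → i < N → t i ≈ 0#) → sumBelow N t ≈ 0#
  sumBelow-zeros zero    t≈0 = refl
  sumBelow-zeros (suc N) t≈0 =
    trans (+-cong (sumBelow-zeros N (λ i i<N → t≈0 i (ℕP.m<n⇒m<1+n i<N))) (t≈0 N (ℕP.n<1+n N)))
          (+-identityˡ 0#)

  sumBelow-+ : ∀ N {s t : ℕ → Carrier} → sumBelow N (λ i → s i + t i) ≈ sumBelow N s + sumBelow N t
  sumBelow-+ zero    = sym (+-identityˡ 0#)
  sumBelow-+ (suc N) = trans (+-congʳ (sumBelow-+ N)) (interchange _ _ _ _)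

  sumBelow-distribˡ : ∀ N x {t : ℕ → Carrier} → sumBelow N (λ i → x * t i) ≈ x * sumBelow N t
  sumBelow-distribˡ zero    x = sym (zeroʳ x)
  sumBelow-distribˡ (suc N) x = trans (+-congʳ (sumBelow-distribˡ N x)) (sym (distribˡ x _ _))

  sumBelow-distribʳ : ∀ N x {t : ℕ → Carrier} → sumBelow N (λ i → t i * x) ≈ sumBelow N t * x
  sumBelow-distribʳ zero    x = sym (zeroˡ x)
  sumBelow-distribʳ (suc N) x = trans (+-congʳ (sumBelow-distribʳ N x)) (sym (distribʳ x _ _))

  sumBelow-tail : ∀ {m N} {t : ℕ → Carrier} → m ≤ N → (∀ j → m ≤ j → t j ≈ 0#) →
                  sumBelow N t ≈ sumBelow m t
  sumBelow-tail {m} {_} {t} m≤N t≈0 = go (ℕP.≤⇒≤′ m≤N)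
    where
    go : ∀ {N} → m ≤′ N → sumBelow N t ≈ sumBelow m t
    go ≤′-refl        = refl
    go (≤′-step m≤′N) = trans (+-cong (go m≤′N) (t≈0 _ (ℕP.≤′⇒≤ m≤′N))) (+-identityʳ _)

  sumBelow-comm : ∀ M N {E : ℕ → ℕ → Carrier} →
                  sumBelow M (λ i → sumBelow N (E i)) ≈ sumBelow N (λ j → sumBelow M (λ i → E i j))
  sumBelow-comm zero    N = sym (sumBelow-zeros N (λ _ _ → refl))
  sumBelow-comm (suc M) N = trans (+-congʳ (sumBelow-comm M N)) (sym (sumBelow-+ N))

  sumBelow-triangle : ∀ N (F : ℕ → ℕ → Carrier) →
                      sumBelow N (λ k → sumBelow (suc k) (λ i → F i (k ∸ i))) ≈
                      sumBelow N (λ i → sumBelow (N ∸ i) (F i))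
  sumBelow-triangle zero    F = refl
  sumBelow-triangle (suc N) F = begin
      sumBelow N (λ k → sumBelow (suc k) (λ i → F i (k ∸ i))) + (diagonal + F N (N ∸ N))
    ≈⟨ +-congʳ (sumBelow-triangle N F) ⟩
      sumBelow N (λ i → sumBelow (N ∸ i) (F i)) + (diagonal + F N (N ∸ N))
    ≈⟨ sym (+-assoc _ _ _) ⟩
      (sumBelow N (λ i → sumBelow (N ∸ i) (F i)) + diagonal) + F N (N ∸ N)
    ≈⟨ +-cong (sym (sumBelow-+ N)) corner ⟩
      sumBelow N (λ i → sumBelow (N ∸ i) (F i) + F i (N ∸ i)) + sumBelow (suc N ∸ N) (F N)
    ≈⟨ +-congʳ (sumBelow-cong N widen) ⟩
      sumBelow N (λ i → sumBelow (suc N ∸ i) (F i)) + sumBelow (suc N ∸ N) (F N)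
    ∎
    where
    diagonal : Carrier
    diagonal = sumBelow N (λ i → F i (N ∸ i))
    corner : F N (N ∸ N) ≈ sumBelow (suc N ∸ N) (F N)
    corner rewrite ℕP.n∸n≡0 N | ℕP.m+n∸n≡m 1 N = sym (+-identityˡ _)
    widen : ∀ i → i < N → sumBelow (N ∸ i) (F i) + F i (N ∸ i) ≈ sumBelow (suc N ∸ i) (F i)
    widen i i<N = reflexive (PE.cong (λ m → sumBelow m (F i)) (PE.sym (ℕP.+-∸-assoc 1 (ℕP.<⇒≤ i<N))))

  sumBelow-cauchy : ∀ N (a b w : ℕ → Carrier) → (∀ k → N ≤ k → w k ≈ 0#) →
                    sumBelow N (λ i → a i * sumBelow N (λ j → b j * w (i ℕ.+ j))) ≈
                    sumBelow N (λ k → (a ⋆ b) k * w k)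
  sumBelow-cauchy N a b w w≈0 = begin
      sumBelow N (λ i → a i * sumBelow N (λ j → b j * w (i ℕ.+ j)))
    ≈⟨ sumBelow-cong N (λ i _ → trans (*-congˡ (shorten i)) (sym (sumBelow-distribˡ (N ∸ i) (a i)))) ⟩
      sumBelow N (λ i → sumBelow (N ∸ i) (λ j → a i * (b j * w (i ℕ.+ j))))
    ≈⟨ sym (sumBelow-triangle N (λ i j → a i * (b j * w (i ℕ.+ j)))) ⟩
      sumBelow N (λ k → sumBelow (suc k) (λ i → a i * (b (k ∸ i) * w (i ℕ.+ (k ∸ i)))))
    ≈⟨ sumBelow-cong N (λ k _ → trans (sumBelow-cong (suc k) (reassociate k)) (sumBelow-distribʳ (suc k) (w k))) ⟩
      sumBelow N (λ k → (a ⋆ b) k * w k)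
    ∎
    where
    shorten : ∀ i → sumBelow N (λ j → b j * w (i ℕ.+ j)) ≈ sumBelow (N ∸ i) (λ j → b j * w (i ℕ.+ j))
    shorten i = sumBelow-tail (ℕP.m∸n≤m N i) λ j N∸i≤j →
      trans (*-congˡ (w≈0 _ (ℕP.≤-trans (ℕP.m≤n+m∸n N i) (ℕP.+-monoʳ-≤ i N∸i≤j)))) (zeroʳ _)
    reassociate : ∀ k i → i < suc k → a i * (b (k ∸ i) * w (i ℕ.+ (k ∸ i))) ≈ (a i * b (k ∸ i)) * w k
    reassociate k i i<1+k =
      trans (*-congˡ (*-congˡ (reflexive (PE.cong w (ℕP.m+[n∸m]≡n (ℕP.<⇒≤pred i<1+k))))))
            (sym (*-assoc _ _ _))

module LinearOperators {c ℓ : Level} (K : Field₀ c ℓ) where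
  open PowerSeries K

  ^ₒ-+ : ∀ (T : Op) i j u → (T ^ₒ i) ((T ^ₒ j) u) ≡ (T ^ₒ (i ℕ.+ j)) u
  ^ₒ-+ T zero    j u = PE.refl
  ^ₒ-+ T (suc i) j u = PE.cong T (^ₒ-+ T i j u)

  linear-id : Linear id
  linear-id = record { cong = id ; additive = λ _ _ _ → refl ; homog = λ _ _ _ → refl }

  linear-∘ : ∀ {A B} → Linear A → Linear B → Linear (A ∘ₒ B)
  linear-∘ {A} {B} linA linB = record
    { cong     = λ f≈g → A.cong (B.cong f≈g)
    ; additive = λ f g n → trans (A.cong (B.additive f g) n) (A.additive _ _ n)
    ; homog    = λ a f n → trans (A.cong (B.homog a f) n) (A.homog _ _ n)
    }
    where
    module A = Linear linA
    module B = Linear linB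

  linear-^ : ∀ {T} → Linear T → ∀ i → Linear (T ^ₒ i)
  linear-^ lin zero    = linear-id
  linear-^ lin (suc i) = linear-∘ lin (linear-^ lin i)

  module _ {A : Op} (lin : Linear A) where
    open Linear lin

    linear-zero : A zeroₛ ≈ₛ zeroₛ
    linear-zero n = trans (cong (λ _ → sym (zeroˡ 0#)) n) (trans (homog 0# zeroₛ n) (zeroˡ _))

    linear-partialSum : ∀ (b : Series) T N u n →
                        A (partialSum b T N u) n ≈ sumBelow N (λ j → b j * A ((T ^ₒ j) u) n)
    linear-partialSum b T zero    u n = linear-zero n
    linear-partialSum b T (suc N) u n =
      trans (additive _ _ n) (+-cong (linear-partialSum b T N u n) (homog _ _ n))

module Order {c ℓ : Level} (K : Field₀ c ℓ) where
  open PowerSeries K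
  open FiniteSums K
  open LinearOperators K
  open RingProperties (CommutativeRing.ring commRing) using (\\-leftDividesˡ; +-cancelˡ)
  open import Relation.Binary.Reasoning.Setoid setoid

  RaisesOrder : Op → Set (c ⊔ ℓ)
  RaisesOrder T = ∀ {u v k} → AgreeBelow u v k → AgreeBelow (T u) (T v) (suc k)

  PowersRaiseOrder : Op → Set (c ⊔ ℓ)
  PowersRaiseOrder S = ∀ i u → AgreeBelow ((S ^ₒ i) u) zeroₛ i

  _[_≔_] : Series → ℕ → Carrier → Series
  (h [ k ≔ a ]) n with n ℕ.≟ k
  ... | yes _ = a
  ... | no  _ = h n

  monomial : ℕ → Series
  monomial k = zeroₛ [ k ≔ 1# ]

  [≔]-orderDiff : ∀ {u v k a} → AgreeBelow u v k → ¬ (a ≈ v k) → OrderDiff (u [ k ≔ a ]) v k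
  [≔]-orderDiff {u} {v} {k} {a} u≈v a≉vk = below , at
    where
    below : AgreeBelow (u [ k ≔ a ]) v k
    below n n<k with n ℕ.≟ k
    ... | yes n≡k = ⊥-elim (ℕP.<⇒≢ n<k n≡k)
    ... | no  _   = u≈v n n<k
    at : ¬ ((u [ k ≔ a ]) k ≈ v k)
    at with k ℕ.≟ k
    ... | yes _   = a≉vk
    ... | no  k≢k = ⊥-elim (k≢k PE.refl)

  monomial-orderDiff : ∀ k → OrderDiff (monomial k) zeroₛ k
  monomial-orderDiff k = [≔]-orderDiff (λ _ _ → refl) (λ 1≈0 → 0≉1 (sym 1≈0))

  [≔]-decomposition : ∀ u k a → u ≈ₛ ((u [ k ≔ a ]) +ₛ ((- a + u k) ·ₛ monomial k))
  [≔]-decomposition u k a n with n ℕ.≟ k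
  ... | yes PE.refl = sym (trans (+-congˡ (*-identityʳ _)) (\\-leftDividesˡ a (u n)))
  ... | no  _       = sym (trans (+-congˡ (zeroʳ _)) (+-identityʳ _))

  contractive⇒orderDiff-step : ∀ {T f g k} → Contractive T → OrderDiff f g k →
                               AgreeBelow (T f) (T g) (suc k)
  contractive⇒orderDiff-step {f = f} {g} {k} (_ , _ , q<1 , contract) f~g =
    contract f g k f~g k (*half^<half^ k q<1)

  -- Contractivity only controls pairs at exact distance 2^-k, and whether u k ≈ v k is
  -- undecidable; so u is split as u[k ≔ v k + 1], at exact distance 2^-k from v, plus a
  -- multiple of x^k, at exact distance 2^-k from 0.
  contractive⇒raisesOrder : ∀ {T} → Linear T → Contractive T → RaisesOrder T
  contractive⇒raisesOrder {T} lin contr {u} {v} {k} u≈v n n<1+k = begin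
      T u n
    ≈⟨ cong ([≔]-decomposition u k a) n ⟩
      T ((u [ k ≔ a ]) +ₛ (b ·ₛ monomial k)) n
    ≈⟨ additive _ _ n ⟩
      T (u [ k ≔ a ]) n + T (b ·ₛ monomial k) n
    ≈⟨ +-congˡ (homog b _ n) ⟩
      T (u [ k ≔ a ]) n + b * T (monomial k) n
    ≈⟨ +-cong (step ([≔]-orderDiff u≈v a≉vk) n n<1+k)
              (*-congˡ (trans (step (monomial-orderDiff k) n n<1+k) (linear-zero lin n))) ⟩
      T v n + b * 0#
    ≈⟨ trans (+-congˡ (zeroʳ b)) (+-identityʳ _) ⟩
      T v n
    ∎
    where
    open Linear lin
    step : ∀ {f g k} → OrderDiff f g k → AgreeBelow (T f) (T g) (suc k)
    step = contractive⇒orderDiff-step contr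
    a b : Carrier
    a = v k + 1#
    b = - a + u k
    a≉vk : ¬ (a ≈ v k)
    a≉vk a≈vk = 0≉1 (sym (+-cancelˡ (v k) 1# 0# (trans a≈vk (sym (+-identityʳ (v k))))))

  raisesOrder-^ : ∀ {T} → RaisesOrder T → ∀ i {u v k} → AgreeBelow u v k →
                  AgreeBelow ((T ^ₒ i) u) ((T ^ₒ i) v) (i ℕ.+ k)
  raisesOrder-^ raises zero    u≈v = u≈v
  raisesOrder-^ raises (suc i) u≈v = raises (raisesOrder-^ raises i u≈v)

  raisesOrder⇒powersRaiseOrder : ∀ {T} → Linear T → RaisesOrder T → PowersRaiseOrder T
  raisesOrder⇒powersRaiseOrder lin raises i u n n<i =
    trans (raisesOrder-^ raises i {u} {zeroₛ} {0} (λ _ ()) n (ℕP.<-≤-trans n<i (ℕP.m≤m+n i 0)))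
          (linear-zero (linear-^ lin i) n)

  ^ₛ-order≥ : ∀ {g} → g 0 ≈ 0# → ∀ i → AgreeBelow (g ^ₛ i) zeroₛ i
  ^ₛ-order≥     g0≈0 zero    k ()
  ^ₛ-order≥ {g} g0≈0 (suc i) k k<1+i = sumBelow-zeros (suc k) term≈0
    where
    term≈0 : ∀ j → j < suc k → g j * (g ^ₛ i) (k ∸ j) ≈ 0#
    term≈0 zero    _     = trans (*-congʳ g0≈0) (zeroˡ _)
    term≈0 (suc j) j<1+k = trans (*-congˡ (^ₛ-order≥ g0≈0 i (k ∸ suc j) k∸[1+j]<i)) (zeroʳ _)
      where
      k∸[1+j]<i : k ∸ suc j < i
      k∸[1+j]<i = ℕP.<-≤-trans (ℕP.∸-monoʳ-< (s≤s z≤n) (ℕP.<⇒≤pred j<1+k)) (ℕP.<⇒≤pred k<1+i)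

module Evaluation {c ℓ : Level} (K : Field₀ c ℓ) where
  open PowerSeries K
  open FiniteSums K
  open LinearOperators K
  open Order K
  open import Relation.Binary.Reasoning.Setoid setoid

  evalCoeff : Op → Series → Series → ℕ → Carrier
  evalCoeff S e u n = sumBelow (suc n) (λ k → e k * (S ^ₒ k) u n)

  EvalCoeffs : Op → Series → Op → Set (c ⊔ ℓ)
  EvalCoeffs S e A = ∀ u n → A u n ≈ evalCoeff S e u n

  evalCoeffs-unique : ∀ {S e A B} → EvalCoeffs S e A → EvalCoeffs S e B → A ≈ₒ B
  evalCoeffs-unique A≈ B≈ u n = trans (A≈ u n) (sym (B≈ u n))

  partialSum-coeff : ∀ e S N u n → partialSum e S N u n ≡ sumBelow N (λ k → e k * (S ^ₒ k) u n)
  partialSum-coeff e S zero    u n = PE.refl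
  partialSum-coeff e S (suc N) u n = PE.cong (_+ e N * (S ^ₒ N) u n) (partialSum-coeff e S N u n)

  module _ {S : Op} (powers : PowersRaiseOrder S) where

    partialSum≈evalCoeff : ∀ e u {n N} → n < N → partialSum e S N u n ≈ evalCoeff S e u n
    partialSum≈evalCoeff e u {n} {N} n<N = begin
        partialSum e S N u n
      ≡⟨ partialSum-coeff e S N u n ⟩
        sumBelow N (λ k → e k * (S ^ₒ k) u n)
      ≈⟨ sumBelow-tail n<N (λ k n<k → trans (*-congˡ (powers k u n n<k)) (zeroʳ _)) ⟩
        evalCoeff S e u n
      ∎

    isEval⇒evalCoeffs : ∀ {e A} → IsEval S e A → EvalCoeffs S e A
    isEval⇒evalCoeffs {e} {A} converges u n with converges u (suc n)
    ... | N , agree = begin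
        A u n
      ≈⟨ sym (agree M (ℕP.m≤n+m N (suc n)) n (ℕP.n<1+n n)) ⟩
        partialSum e S M u n
      ≈⟨ partialSum≈evalCoeff e u (ℕP.m≤m+n (suc n) N) ⟩
        evalCoeff S e u n
      ∎
      where
      M : ℕ
      M = suc n ℕ.+ N

    evalCoeffs⇒agreeBelow-partialSum : ∀ {e A} → EvalCoeffs S e A → ∀ u N →
                                       AgreeBelow (A u) (partialSum e S N u) N
    evalCoeffs⇒agreeBelow-partialSum {e} A≈ u N n n<N =
      trans (A≈ u n) (sym (partialSum≈evalCoeff e u n<N))

  module _ {S : Op} where

    evalCoeffs-+ : ∀ {f g F G} → EvalCoeffs S f F → EvalCoeffs S g G → EvalCoeffs S (f +ₛ g) (F +ₒ G)
    evalCoeffs-+ {f} {g} {F} {G} F≈ G≈ u n = begin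
        F u n + G u n
      ≈⟨ +-cong (F≈ u n) (G≈ u n) ⟩
        evalCoeff S f u n + evalCoeff S g u n
      ≈⟨ sym (sumBelow-+ (suc n)) ⟩
        sumBelow (suc n) (λ k → f k * (S ^ₒ k) u n + g k * (S ^ₒ k) u n)
      ≈⟨ sumBelow-cong (suc n) (λ k _ → sym (distribʳ _ _ _)) ⟩
        evalCoeff S (f +ₛ g) u n
      ∎

    evalCoeffs-· : ∀ {f F} a → EvalCoeffs S f F → EvalCoeffs S (a ·ₛ f) (a ·ₒ F)
    evalCoeffs-· {f} {F} a F≈ u n = begin
        a * F u n
      ≈⟨ *-congˡ (F≈ u n) ⟩
        a * evalCoeff S f u n
      ≈⟨ sym (sumBelow-distribˡ (suc n) a) ⟩
        sumBelow (suc n) (λ k → a * (f k * (S ^ₒ k) u n))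
      ≈⟨ sumBelow-cong (suc n) (λ k _ → sym (*-assoc _ _ _)) ⟩
        evalCoeff S (a ·ₛ f) u n
      ∎

    evalCoeffs-oneₛ : EvalCoeffs S oneₛ id
    evalCoeffs-oneₛ u n = begin
        u n
      ≈⟨ trans (+-identityˡ _) (*-identityˡ _) ⟨
        sumBelow 1 (λ k → oneₛ k * (S ^ₒ k) u n)
      ≈⟨ sumBelow-tail (s≤s (z≤n {n})) higher≈0 ⟨
        evalCoeff S oneₛ u n
      ∎
      where
      higher≈0 : ∀ k → 1 ≤ k → oneₛ k * (S ^ₒ k) u n ≈ 0#
      higher≈0 (suc k) _ = zeroˡ _

  module Composition {T : Op} (lin : Linear T) (raises : RaisesOrder T) where

    powers : PowersRaiseOrder T
    powers = raisesOrder⇒powersRaiseOrder lin raises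

    evalCoeffs-⋆ : ∀ {a b A B} → EvalCoeffs T a A → EvalCoeffs T b B → EvalCoeffs T (a ⋆ b) (A ∘ₒ B)
    evalCoeffs-⋆ {a} {b} {A} {B} A≈ B≈ u n = begin
        A (B u) n
      ≈⟨ A≈ (B u) n ⟩
        sumBelow (suc n) (λ i → a i * (T ^ₒ i) (B u) n)
      ≈⟨ sumBelow-cong (suc n) (λ i _ → *-congˡ (expand i)) ⟩
        sumBelow (suc n) (λ i → a i * sumBelow (suc n) (λ j → b j * (T ^ₒ (i ℕ.+ j)) u n))
      ≈⟨ sumBelow-cauchy (suc n) a b (λ k → (T ^ₒ k) u n) (λ k → powers k u n) ⟩
        evalCoeff T (a ⋆ b) u n
      ∎
      where
      expand : ∀ i → (T ^ₒ i) (B u) n ≈ sumBelow (suc n) (λ j → b j * (T ^ₒ (i ℕ.+ j)) u n)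
      expand i = begin
          (T ^ₒ i) (B u) n
        ≈⟨ raisesOrder-^ raises i (evalCoeffs⇒agreeBelow-partialSum powers B≈ u (suc n))
                         n (ℕP.m≤n+m (suc n) i) ⟩
          (T ^ₒ i) (partialSum b T (suc n) u) n
        ≈⟨ linear-partialSum (linear-^ lin i) b T (suc n) u n ⟩
          sumBelow (suc n) (λ j → b j * (T ^ₒ i) ((T ^ₒ j) u) n)
        ≈⟨ sumBelow-cong (suc n) (λ j _ → *-congˡ (reflexive (PE.cong (λ v → v n) (^ₒ-+ T i j u)))) ⟩
          sumBelow (suc n) (λ j → b j * (T ^ₒ (i ℕ.+ j)) u n)
        ∎

    evalCoeffs-^ : ∀ {g G} → EvalCoeffs T g G → ∀ i → EvalCoeffs T (g ^ₛ i) (G ^ₒ i)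
    evalCoeffs-^ G≈ zero    = evalCoeffs-oneₛ
    evalCoeffs-^ G≈ (suc i) = evalCoeffs-⋆ G≈ (evalCoeffs-^ G≈ i)

    evalCoeffs⇒powersRaiseOrder : ∀ {g G} → g 0 ≈ 0# → EvalCoeffs T g G → PowersRaiseOrder G
    evalCoeffs⇒powersRaiseOrder g0≈0 G≈ i u n n<i =
      trans (evalCoeffs-^ G≈ i u n) (sumBelow-zeros (suc n) λ k k≤n →
        trans (*-congʳ (^ₛ-order≥ g0≈0 i k (ℕP.<-≤-trans k≤n n<i))) (zeroˡ _))

    evalCoeffs-∘ₛ : ∀ {f g F G} → g 0 ≈ 0# → EvalCoeffs T g G → IsEval G f F →
                    EvalCoeffs T (f ∘ₛ g) F
    evalCoeffs-∘ₛ {f} {g} {F} {G} g0≈0 G≈ isF u n = begin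
        F u n
      ≈⟨ isEval⇒evalCoeffs (evalCoeffs⇒powersRaiseOrder g0≈0 G≈) isF u n ⟩
        sumBelow (suc n) (λ i → f i * (G ^ₒ i) u n)
      ≈⟨ sumBelow-cong (suc n) (λ i _ →
           trans (*-congˡ (evalCoeffs-^ G≈ i u n)) (sym (sumBelow-distribˡ (suc n) (f i)))) ⟩
        sumBelow (suc n) (λ i → sumBelow (suc n) (λ k → f i * ((g ^ₛ i) k * w k)))
      ≈⟨ sumBelow-comm (suc n) (suc n) ⟩
        sumBelow (suc n) (λ k → sumBelow (suc n) (λ i → f i * ((g ^ₛ i) k * w k)))
      ≈⟨ sumBelow-cong (suc n) collect ⟩
        evalCoeff T (f ∘ₛ g) u n
      ∎
      where
      w : ℕ → Carrier
      w k = (T ^ₒ k) u n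
      collect : ∀ k → k < suc n → sumBelow (suc n) (λ i → f i * ((g ^ₛ i) k * w k)) ≈ (f ∘ₛ g) k * w k
      collect k k≤n = begin
          sumBelow (suc n) (λ i → f i * ((g ^ₛ i) k * w k))
        ≈⟨ sumBelow-tail k≤n (λ i k<i →
             trans (*-congˡ (trans (*-congʳ (^ₛ-order≥ g0≈0 i k k<i)) (zeroˡ _))) (zeroʳ _)) ⟩
          sumBelow (suc k) (λ i → f i * ((g ^ₛ i) k * w k))
        ≈⟨ sumBelow-cong (suc k) (λ i _ → sym (*-assoc _ _ _)) ⟩
          sumBelow (suc k) (λ i → (f i * (g ^ₛ i) k) * w k)
        ≈⟨ sumBelow-distribʳ (suc k) (w k) ⟩
          (f ∘ₛ g) k * w k
        ∎

mainTheorem1 : {c ℓ : Level} (K : Field₀ c ℓ) →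
    let open PowerSeries K in
    (f g : Series) (λ' : Carrier) (T : Op) → Linear T → Contractive T →
      -- (a) (f+g)(T) = f(T) + g(T)
      (∀ F G S → IsEval T f F → IsEval T g G → IsEval T (f +ₛ g) S →
        S ≈ₒ (F +ₒ G))
      -- (b) (λ f)(T) = λ f(T)
      × (∀ F L → IsEval T f F → IsEval T (λ' ·ₛ f) L → L ≈ₒ (λ' ·ₒ F))
      -- (c) f(T) ∘ g(T) = (f·g)(T)
      × (∀ F G P → IsEval T f F → IsEval T g G → IsEval T (f ⋆ g) P →
        (F ∘ₒ G) ≈ₒ P)
      -- (d) g(0) = 0 ⇒ f(g(T)) = (f∘g)(T)
      × (g 0 ≈ 0# → ∀ G F H → IsEval T g G → IsEval G f F →
        IsEval T (f ∘ₛ g) H → F ≈ₒ H)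
mainTheorem1 K f g λ' T lin contr =
    (λ F G S isF isG isS → evalCoeffs-unique (coeffs isS) (evalCoeffs-+ (coeffs isF) (coeffs isG)))
  , (λ F L isF isL → evalCoeffs-unique (coeffs isL) (evalCoeffs-· λ' (coeffs isF)))
  , (λ F G P isF isG isP → evalCoeffs-unique (evalCoeffs-⋆ (coeffs isF) (coeffs isG)) (coeffs isP))
  , (λ g0≈0 G F H isG isF isH → evalCoeffs-unique (evalCoeffs-∘ₛ g0≈0 (coeffs isG) isF) (coeffs isH))
  where
  open PowerSeries K
  open Order K using (contractive⇒raisesOrder)
  open Evaluation K
  open Composition lin (contractive⇒raisesOrder lin contr)
  coeffs : ∀ {e A} → IsEval T e A → EvalCoeffs T e A
  coeffs = isEval⇒evalCoeffs powers
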